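{- Let $k\le n$ and let $\mathcal{B}$ be a (non-empty) collection of admissible subsets of $E_{\pm n}=[n]\cup[n]^*$, each of cardinality $k$. If $\mathcal{B}$ satisfies the Symmetric Exchange Axiom, then $\mathcal{B}$ satisfies the Maximality Property.
   Context: $[n]^*=\{1^*,\dots,n^*\}$ and $*$ is the involution $i\leftrightarrow i^*$; $S^*=\{s^*:s\in S\}$. A set $S\subseteq E_{\pm n}$ is admissible if $S\cap S^*=\emptyset$. A linear ordering $<$ on $E_{\pm n}$ is admissible if $i<j$ implies $j^*<i^*$. For admissible $k$-sets $A=\{a_1<\dots<a_k\}$, $B=\{b_1<\dots<b_k\}$ set $A\le B$ iff $a_i\le b_i$ for all $i$. Symmetric Exchange Axiom: for every $X,Y\in\mathcal{B}$ and every $i\in Y-X$, there exists $j\in X-Y$ such that $X\cup\{i\}-\{j\}\in\mathcal{B}$. Maximality Property: for every admissible ordering $<$ of $E_{\pm n}$, $\mathcal{B}$ contains a unique maximal element with respect to the induced order $\le$ on admissible $k$-sets (equivalently, $(E_{\pm n};\mathcal{B})$ is a symplectic matroid). -}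

module Defs where

open import Data.Nat using (ℕ; _+_)
open import Data.Bool using (Bool; true; false; not)
open import Data.Fin using (Fin)
import Data.Fin as Fin
open import Data.Fin.Subset using (Subset; inside; outside) renaming (_∈_ to _∈ₛ_; ∣_∣ to ∣_∣ₛ)
open import Data.Vec using (_[_]≔_)
open import Data.Product using (_×_; _,_; Σ; ∃; ∃-syntax; proj₁; proj₂)
open import Data.Sum using (_⊎_)
open import Data.List using (List)
open import Data.List.Membership.Propositional using () renaming (_∈_ to _∈L_)
open import Relation.Binary.PropositionalEquality using (_≡_)
open import Relation.Binary.Structures using (IsStrictTotalOrder)
open import Relation.Binary.Core using (Rel)
open import Relation.Nullary using (¬_)
open import Data.Empty using (⊥)

-- The ground set E_{±n} = [n] ∪ [n]*.
-- (i , true) stands for i ∈ [n],  (i , false) stands for i* ∈ [n]*.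

E : ℕ → Set
E n = Fin n × Bool

_* : ∀ {n} → E n → E n
(i , b) * = (i , not b)

-- Subsets of E_{±n}: a pair (P , N) of subsets of [n];
-- P = the unstarred elements, N = the indices of the starred elements.

ESet : ℕ → Set
ESet n = Subset n × Subset n

infix 4 _∈E_ _∉E_
_∈E_ : ∀ {n} → E n → ESet n → Set
(i , true)  ∈E (P , N) = i ∈ₛ P
(i , false) ∈E (P , N) = i ∈ₛ N

_∉E_ : ∀ {n} → E n → ESet n → Set
x ∉E S = ¬ (x ∈E S)

∣_∣E : ∀ {n} → ESet n → ℕ
∣ (P , N) ∣E = ∣ P ∣ₛ + ∣ N ∣ₛ

star : ∀ {n} → ESet n → ESet n
star (P , N) = (N , P)

insertE : ∀ {n} → E n → ESet n → ESet n
insertE (i , true)  (P , N) = (P [ i ]≔ inside , N)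
insertE (i , false) (P , N) = (P , N [ i ]≔ inside)

removeE : ∀ {n} → E n → ESet n → ESet n
removeE (i , true)  (P , N) = (P [ i ]≔ outside , N)
removeE (i , false) (P , N) = (P , N [ i ]≔ outside)

Admissible : ∀ {n} → ESet n → Set
Admissible S = ∀ x → x ∈E S → x ∈E star S → ⊥

record AdmissibleOrder (n : ℕ) : Set₁ where
  field
    _<_ : Rel (E n) _
    isStrictTotalOrder : IsStrictTotalOrder _≡_ _<_
    admissible : ∀ {i j} → i < j → (j *) < (i *)

module _ {n : ℕ} (O : AdmissibleOrder n) where
  open AdmissibleOrder O

  _≤O_ : E n → E n → Set
  x ≤O y = x < y ⊎ x ≡ y

  Enumerates : ∀ {k} → ESet n → (Fin k → E n) → Set
  Enumerates A a =
    (∀ i j → i Fin.< j → a i < a j) ×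
    (∀ x → (x ∈E A → ∃[ i ] a i ≡ x) × (∀ i → a i ≡ x → x ∈E A))

  GaleLeq : ℕ → ESet n → ESet n → Set
  GaleLeq k A B = (a b : Fin k → E n) → Enumerates A a → Enumerates B b →
                  ∀ i → a i ≤O b i

SymmetricExchange : ∀ {n} → List (ESet n) → Set
SymmetricExchange {n} 𝓑 =
  ∀ X Y → X ∈L 𝓑 → Y ∈L 𝓑 → ∀ (i : E n) → i ∈E Y → i ∉E X →
  ∃[ j ] (j ∈E X × j ∉E Y × removeE j (insertE i X) ∈L 𝓑)

MaximalIn : ∀ {n} → AdmissibleOrder n → ℕ → List (ESet n) → ESet n → Set
MaximalIn O k 𝓑 M = M ∈L 𝓑 × (∀ X → X ∈L 𝓑 → GaleLeq O k M X → X ≡ M)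

MaximalityProperty : ∀ {n} → ℕ → List (ESet n) → Set₁
MaximalityProperty {n} k 𝓑 =
  (O : AdmissibleOrder n) →
  ∃[ M ] (MaximalIn O k 𝓑 M × (∀ M′ → MaximalIn O k 𝓑 M′ → M′ ≡ M))

module Submission where

-- Fix an admissible order ≺ on E_{±n}, let rank x be the number of elements below x,
-- and choose A ∈ 𝓑 of maximal total rank. Then
--  * every exchange A − j + y ∈ 𝓑 with y ∉ A, j ∈ A has y ≺ j, or A would not be heaviest;
--  * for every threshold t and every B ∈ 𝓑, B has at most as many elements not below t
--    as A. By induction on |B ∖ A|: exchanging the greatest y ∈ B ∖ A into A gives
--    j′ ∈ A ∖ B with y ≺ j′; exchanging j′ into B gives j ∈ B ∖ A, and since j ≼ y ≺ j′
--    the set B − j + j′ ∈ 𝓑 is closer to A and has no smaller threshold counts;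
--  * for k-sets, domination of all threshold counts implies the induced (Gale) order,
--    so A lies above every member of 𝓑, and antisymmetry makes A the unique maximum.

open import Defs
open import Data.Nat using (ℕ; zero; suc; _+_; _≤_; _<_; z≤n; s≤s)
import Data.Nat.Properties as ℕ
open import Data.Nat.ListAction using (sum)
open import Algebra.Properties.CommutativeSemigroup ℕ.+-commutativeSemigroup using (x∙yz≈y∙xz)
open import Data.Bool using (true; false)
open import Data.Fin using (Fin; zero; suc)
import Data.Fin as Fin
import Data.Fin.Properties as Fin
open import Data.Fin.Subset using (Subset; inside; outside) renaming (_∈_ to _∈ₛ_; ∣_∣ to ∣_∣ₛ)
open import Data.Fin.Subset.Properties using (_∈?_; drop-there; ⊆-antisym)
open import Data.Vec using ([]; _∷_; here; there; _[_]≔_)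
open import Data.Vec.Properties using ([]≔-updates; []≔-minimal; []=⇒lookup; lookup⇒[]=; lookup∘updateAt′; []=-injective)
open import Data.Product using (_×_; _,_; Σ; ∃-syntax; proj₁; proj₂)
open import Data.Sum using (_⊎_; inj₁; inj₂)
open import Data.List using (List; []; _∷_; map; length; filter; tabulate; lookup; allFin; _++_)
open import Data.List.Properties using (filter-++; length-++; length-map)
import Data.List.Extrema.Nat as Extremaℕ
import Data.List.Extrema as Extrema
open import Data.List.Membership.Propositional using (_∈_)
open import Data.List.Membership.Propositional.Properties using (∈-++⁺ˡ; ∈-++⁺ʳ; ∈-tabulate⁺; ∈-tabulate⁻; ∈-lookup; ∈-filter⁺; ∈-filter⁻; ∈-map⁺; ∈-map⁻; ∈-allFin)
open import Data.List.Relation.Binary.Subset.Propositional using (_⊆_)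
open import Data.List.Relation.Unary.Any using (here; there; index)
open import Data.List.Relation.Unary.Any.Properties using (lookup-index; ¬Any[])
open import Data.List.Relation.Unary.All using (All; _∷_)
import Data.List.Relation.Unary.All as All
open import Data.List.Relation.Unary.All.Properties using (all-filter)
open import Data.List.Relation.Unary.Unique.Propositional using (Unique; _∷_)
import Data.List.Relation.Unary.Unique.Propositional.Properties as Unique
open import Data.List.Relation.Binary.Permutation.Propositional using (↭-sym; ↭⇒↭ₛ)
open import Data.List.Relation.Binary.Permutation.Propositional.Properties using (∈-resp-↭; ↭-length)
import Data.List.Relation.Binary.Permutation.Setoid.Properties as Permutation
open import Data.List.Relation.Unary.Sorted.TotalOrder.Properties using (lookup-mono-≤)
import Data.List.Sort as Sort
open import Function using (id; _∘_; _⇔_; mk⇔; Equivalence)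
open import Function.Construct.Identity using (⇔-id)
open import Relation.Binary.Bundles using (StrictTotalOrder)
open import Relation.Binary.Structures using (IsStrictTotalOrder)
open import Relation.Binary.Definitions using (tri<; tri≈; tri>)
import Relation.Binary.Properties.StrictTotalOrder as StrictTotalOrderProperties
open import Relation.Nullary using (¬_; Dec; yes; no; contradiction)
open import Relation.Nullary.Decidable using (_×-dec_; ¬?; decidable-stable)
open import Relation.Unary using (Pred; Decidable)
open import Relation.Binary.PropositionalEquality using (_≡_; _≢_; refl; sym; trans; cong; cong₂; subst; setoid; module ≡-Reasoning)

select : ∀ {p} {P : Set p} → Dec P → ℕ → ℕ
select (yes _) a = a
select (no _)  _ = 0

select-yes : ∀ {p} {P : Set p} → P → (d : Dec P) → ∀ a → select d a ≡ a
select-yes p (yes _) a = refl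
select-yes p (no ¬p) a = contradiction p ¬p

select-no : ∀ {p} {P : Set p} → ¬ P → (d : Dec P) → ∀ a → select d a ≡ 0
select-no ¬p (yes p) a = contradiction p ¬p
select-no ¬p (no _)  a = refl

select-cong : ∀ {p q} {P : Set p} {Q : Set q} → P ⇔ Q → (d : Dec P) (e : Dec Q) → ∀ a → select d a ≡ select e a
select-cong P⇔Q (yes _) (yes _) a = refl
select-cong P⇔Q (yes p) (no ¬q) a = contradiction (Equivalence.to P⇔Q p) ¬q
select-cong P⇔Q (no ¬p) (yes q) a = contradiction (Equivalence.from P⇔Q q) ¬p
select-cong P⇔Q (no _)  (no _)  a = refl

select-× : ∀ {p q} {P : Set p} {Q : Set q} (d : Dec P) (e : Dec Q) a → select d (select e a) ≡ select (d ×-dec e) a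
select-× (yes _) (yes _) a = refl
select-× (yes _) (no _)  a = refl
select-× (no _)  _       a = refl

module _ {a} {A : Set a} where

  sum-select-filter : ∀ {p} {P : Pred A p} (P? : Decidable P) xs →
                      sum (map (λ x → select (P? x) 1) xs) ≡ length (filter P? xs)
  sum-select-filter P? [] = refl
  sum-select-filter P? (x ∷ xs) with P? x
  ... | yes _ = cong suc (sum-select-filter P? xs)
  ... | no _  = sum-select-filter P? xs

  sum-cong : ∀ (g h : A → ℕ) xs → (∀ x → x ∈ xs → g x ≡ h x) → sum (map g xs) ≡ sum (map h xs)
  sum-cong g h []       eq = refl
  sum-cong g h (x ∷ xs) eq = cong₂ _+_ (eq x (here refl)) (sum-cong g h xs (λ z → eq z ∘ there))

  sum-mono : ∀ (g h : A → ℕ) xs → (∀ x → g x ≤ h x) → sum (map g xs) ≤ sum (map h xs)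
  sum-mono g h []       le = z≤n
  sum-mono g h (x ∷ xs) le = ℕ.+-mono-≤ (le x) (sum-mono g h xs le)

  sum-mono-strict : ∀ (g h : A → ℕ) xs {x} → x ∈ xs → (∀ z → g z ≤ h z) → g x < h x →
                    sum (map g xs) < sum (map h xs)
  sum-mono-strict g h (y ∷ xs) (here refl) le lt = ℕ.+-mono-<-≤ lt (sum-mono g h xs le)
  sum-mono-strict g h (y ∷ xs) (there x∈)  le lt = ℕ.+-mono-≤-< (le y) (sum-mono-strict g h xs x∈ le lt)

  sum-update : ∀ (g h : A → ℕ) {xs} {x} c → Unique xs → x ∈ xs → h x ≡ c + g x →
               (∀ z → z ≢ x → h z ≡ g z) → sum (map h xs) ≡ c + sum (map g xs)
  sum-update g h {y ∷ xs} c (y∉xs ∷ _) (here refl) hx others = begin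
    h y + sum (map h xs)       ≡⟨ cong₂ _+_ hx (sum-cong h g xs (λ z z∈ → others z (z≢y z∈))) ⟩
    (c + g y) + sum (map g xs) ≡⟨ ℕ.+-assoc c (g y) _ ⟩
    c + (g y + sum (map g xs)) ∎
    where
    open ≡-Reasoning
    z≢y : ∀ {z} → z ∈ xs → z ≢ y
    z≢y z∈ refl = All.lookup y∉xs z∈ refl
  sum-update g h {y ∷ xs} {x} c (y∉xs ∷ u) (there x∈) hx others = begin
    h y + sum (map h xs)       ≡⟨ cong₂ _+_ (others y y≢x) (sum-update g h c u x∈ hx others) ⟩
    g y + (c + sum (map g xs)) ≡⟨ x∙yz≈y∙xz (g y) c _ ⟩
    c + (g y + sum (map g xs)) ∎
    where
    open ≡-Reasoning
    y≢x : y ≢ x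
    y≢x refl = All.lookup y∉xs x∈ refl

  lookup-injective : ∀ {xs : List A} → Unique xs → ∀ i j → lookup xs i ≡ lookup xs j → i ≡ j
  lookup-injective (_ ∷ _)    zero    zero    _  = refl
  lookup-injective (x∉ ∷ _)   zero    (suc j) eq = contradiction eq (All.lookup x∉ (∈-lookup j))
  lookup-injective (x∉ ∷ _)   (suc i) zero    eq = contradiction (sym eq) (All.lookup x∉ (∈-lookup i))
  lookup-injective (_ ∷ u)    (suc i) (suc j) eq = cong suc (lookup-injective u i j eq)

  unique-⊆-length : ∀ {xs ys : List A} → Unique xs → xs ⊆ ys → length xs ≤ length ys
  unique-⊆-length {xs} {ys} u xs⊆ys = Fin.injective⇒≤ position-injective
    where
    position : Fin (length xs) → Fin (length ys)
    position i = index (xs⊆ys (∈-lookup i))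
    position-injective : ∀ {i j} → position i ≡ position j → i ≡ j
    position-injective {i} {j} eq = lookup-injective u i j (begin
      lookup xs i                  ≡⟨ lookup-index (xs⊆ys (∈-lookup i)) ⟩
      lookup ys (position i)       ≡⟨ cong (lookup ys) eq ⟩
      lookup ys (position j)       ≡⟨ sym (lookup-index (xs⊆ys (∈-lookup j))) ⟩
      lookup xs j                  ∎)
      where open ≡-Reasoning

length-filter-tabulate : ∀ {m a p} {A : Set a} {P : Pred A p} (P? : Decidable P) (g : Fin m → A) (s : Subset m) →
                         (∀ i → P (g i) → i ∈ₛ s) → (∀ i → i ∈ₛ s → P (g i)) →
                         length (filter P? (tabulate g)) ≡ ∣ s ∣ₛ
length-filter-tabulate P? g []      to from = refl
length-filter-tabulate P? g (b ∷ s) to from with b | P? (g zero)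
... | inside  | yes _ = cong suc rest
  where
  rest : length (filter P? (tabulate (g ∘ suc))) ≡ ∣ s ∣ₛ
  rest = length-filter-tabulate P? (g ∘ suc) s (λ i → drop-there ∘ to (suc i)) (λ i → from (suc i) ∘ there)
... | inside  | no ¬p = contradiction (from zero here) ¬p
... | outside | yes p = contradiction (to zero p) λ ()
... | outside | no _  = length-filter-tabulate P? (g ∘ suc) s (λ i → drop-there ∘ to (suc i)) (λ i → from (suc i) ∘ there)

elems : (n : ℕ) → List (E n)
elems n = tabulate (_, true) ++ tabulate (_, false)

elems-complete : ∀ {n} (x : E n) → x ∈ elems n
elems-complete (i , true)  = ∈-++⁺ˡ (∈-tabulate⁺ i)
elems-complete (i , false) = ∈-++⁺ʳ _ (∈-tabulate⁺ i)

elems-unique : ∀ n → Unique (elems n)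
elems-unique n = Unique.++⁺ (Unique.tabulate⁺ (cong proj₁)) (Unique.tabulate⁺ (cong proj₁)) unstarred∩starred
  where
  unstarred∩starred : ∀ {x} → ¬ (x ∈ tabulate (_, true) × x ∈ tabulate (_, false))
  unstarred∩starred (x∈ , x∈*) with ∈-tabulate⁻ {f = _, true} x∈ | ∈-tabulate⁻ {f = _, false} x∈*
  ... | _ , refl | _ , ()

infix 4 _∈E?_
_∈E?_ : ∀ {n} (x : E n) (X : ESet n) → Dec (x ∈E X)
(i , true)  ∈E? (P , N) = i ∈? P
(i , false) ∈E? (P , N) = i ∈? N

members : ∀ {n} → ESet n → List (E n)
members {n} X = filter (_∈E? X) (elems n)

length-members : ∀ {n} (X : ESet n) → length (members X) ≡ ∣ X ∣E
length-members {n} X@(P , N) = begin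
  length (filter (_∈E? X) (tabulate (_, true) ++ tabulate (_, false)))
    ≡⟨ cong length (filter-++ (_∈E? X) (tabulate (_, true)) (tabulate (_, false))) ⟩
  length (filter (_∈E? X) (tabulate (_, true)) ++ filter (_∈E? X) (tabulate (_, false)))
    ≡⟨ length-++ (filter (_∈E? X) (tabulate (_, true))) ⟩
  length (filter (_∈E? X) (tabulate (_, true))) + length (filter (_∈E? X) (tabulate (_, false)))
    ≡⟨ cong₂ _+_ (length-filter-tabulate (_∈E? X) (_, true) P (λ _ → id) (λ _ → id))
                 (length-filter-tabulate (_∈E? X) (_, false) N (λ _ → id) (λ _ → id)) ⟩
  ∣ P ∣ₛ + ∣ N ∣ₛ ∎
  where open ≡-Reasoning

update-other : ∀ {m} (s : Subset m) {i j} b → i ≢ j → i ∈ₛ (s [ j ]≔ b) ⇔ i ∈ₛ s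
update-other s {i} {j} b i≢j = mk⇔
  (λ i∈ → lookup⇒[]= i s (trans (sym (lookup∘updateAt′ i j i≢j s)) ([]=⇒lookup i∈)))
  ([]≔-minimal s i j i≢j)

insert-here : ∀ {n} (x : E n) X → x ∈E insertE x X
insert-here (i , true)  (P , N) = []≔-updates P i
insert-here (i , false) (P , N) = []≔-updates N i

insert-other : ∀ {n} (x z : E n) X → z ≢ x → z ∈E insertE x X ⇔ z ∈E X
insert-other (j , true)  (i , true)  (P , N) z≢x = update-other P inside (z≢x ∘ cong (_, true))
insert-other (j , true)  (i , false) (P , N) z≢x = ⇔-id _
insert-other (j , false) (i , true)  (P , N) z≢x = ⇔-id _
insert-other (j , false) (i , false) (P , N) z≢x = update-other N inside (z≢x ∘ cong (_, false))

remove-here : ∀ {n} (x : E n) X → x ∉E removeE x X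
remove-here (i , true)  (P , N) x∈ with () ← []=-injective x∈ ([]≔-updates P i)
remove-here (i , false) (P , N) x∈ with () ← []=-injective x∈ ([]≔-updates N i)

remove-other : ∀ {n} (x z : E n) X → z ≢ x → z ∈E removeE x X ⇔ z ∈E X
remove-other (j , true)  (i , true)  (P , N) z≢x = update-other P outside (z≢x ∘ cong (_, true))
remove-other (j , true)  (i , false) (P , N) z≢x = ⇔-id _
remove-other (j , false) (i , true)  (P , N) z≢x = ⇔-id _
remove-other (j , false) (i , false) (P , N) z≢x = update-other N outside (z≢x ∘ cong (_, false))

ESet-ext : ∀ {n} {X Y : ESet n} → (∀ x → x ∈E X → x ∈E Y) → (∀ x → x ∈E Y → x ∈E X) → X ≡ Y
ESet-ext X⊆Y Y⊆X = cong₂ _,_ (⊆-antisym (X⊆Y (_ , true)) (Y⊆X (_ , true)))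
                             (⊆-antisym (X⊆Y (_ , false)) (Y⊆X (_ , false)))

weight : ∀ {n} → (E n → ℕ) → ESet n → ℕ
weight {n} f X = sum (map (λ x → select (x ∈E? X) (f x)) (elems n))

weight-insert : ∀ {n} (f : E n → ℕ) X x → x ∉E X → weight f (insertE x X) ≡ f x + weight f X
weight-insert {n} f X x x∉X = sum-update _ _ (f x) (elems-unique n) (elems-complete x) at-x elsewhere
  where
  at-x : select (x ∈E? insertE x X) (f x) ≡ f x + select (x ∈E? X) (f x)
  at-x with x ∈E? insertE x X | x ∈E? X
  ... | yes _  | no _   = sym (ℕ.+-identityʳ (f x))
  ... | no x∉  | _      = contradiction (insert-here x X) x∉
  ... | yes _  | yes x∈ = contradiction x∈ x∉X
  elsewhere : ∀ z → z ≢ x → select (z ∈E? insertE x X) (f z) ≡ select (z ∈E? X) (f z)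
  elsewhere z z≢x = select-cong (insert-other x z X z≢x) _ _ (f z)

weight-remove : ∀ {n} (f : E n → ℕ) X x → x ∈E X → weight f X ≡ f x + weight f (removeE x X)
weight-remove {n} f X x x∈X = sum-update _ _ (f x) (elems-unique n) (elems-complete x) at-x elsewhere
  where
  at-x : select (x ∈E? X) (f x) ≡ f x + select (x ∈E? removeE x X) (f x)
  at-x with x ∈E? X | x ∈E? removeE x X
  ... | yes _ | no _   = sym (ℕ.+-identityʳ (f x))
  ... | _     | yes x∈ = contradiction x∈ (remove-here x X)
  ... | no x∉ | no _   = contradiction x∈X x∉
  elsewhere : ∀ z → z ≢ x → select (z ∈E? X) (f z) ≡ select (z ∈E? removeE x X) (f z)
  elsewhere z z≢x = sym (select-cong (remove-other x z X z≢x) _ _ (f z))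

weight-exchange : ∀ {n} (f : E n → ℕ) X {i j} → i ∉E X → j ∈E X → j ≢ i →
                  f j + weight f (removeE j (insertE i X)) ≡ f i + weight f X
weight-exchange f X {i} {j} i∉X j∈X j≢i = begin
  f j + weight f (removeE j (insertE i X)) ≡⟨ weight-remove f (insertE i X) j j∈X+i ⟨
  weight f (insertE i X)                   ≡⟨ weight-insert f X i i∉X ⟩
  f i + weight f X                         ∎
  where
  open ≡-Reasoning
  j∈X+i : j ∈E insertE i X
  j∈X+i = Equivalence.from (insert-other i j X j≢i) j∈X

weight-mono : ∀ {n} (f : E n → ℕ) {X Y} → (∀ z → z ∈E X → z ∈E Y) → weight f X ≤ weight f Y
weight-mono {n} f {X} {Y} X⊆Y = sum-mono _ _ (elems n) pointwise
  where
  pointwise : ∀ z → select (z ∈E? X) (f z) ≤ select (z ∈E? Y) (f z)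
  pointwise z with z ∈E? X | z ∈E? Y
  ... | yes _   | yes _   = ℕ.≤-refl
  ... | no _    | _       = z≤n
  ... | yes z∈X | no z∉Y  = contradiction (X⊆Y z z∈X) z∉Y

module OrderFacts {n : ℕ} (O : AdmissibleOrder n) where
  open AdmissibleOrder O renaming (_<_ to _≺_)
  open IsStrictTotalOrder isStrictTotalOrder using (compare; _<?_; irrefl; asym) renaming (trans to ≺-trans)

  -- The order as a library bundle, to reuse the library's sorting and maxima.
  strictTotalOrder : StrictTotalOrder _ _ _
  strictTotalOrder = record { isStrictTotalOrder = isStrictTotalOrder }

  open StrictTotalOrderProperties strictTotalOrder using (decTotalOrder; totalOrder)
  open Sort decTotalOrder using (sort; sort-↭; sort-↗)

  infix 4 _≼_
  _≼_ : E n → E n → Set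
  _≼_ = _≤O_ O

  ≼-≺-trans : ∀ {x y z} → x ≼ y → y ≺ z → x ≺ z
  ≼-≺-trans (inj₁ x≺y) y≺z = ≺-trans x≺y y≺z
  ≼-≺-trans (inj₂ refl) y≺z = y≺z

  ≼-antisym : ∀ {x y} → x ≼ y → y ≼ x → x ≡ y
  ≼-antisym (inj₂ x≡y) _          = x≡y
  ≼-antisym (inj₁ _)   (inj₂ y≡x) = sym y≡x
  ≼-antisym (inj₁ x≺y) (inj₁ y≺x) = contradiction y≺x (asym x≺y)

  ≼⇒⊀ : ∀ {x y} → x ≼ y → ¬ (y ≺ x)
  ≼⇒⊀ (inj₁ x≺y) = asym x≺y
  ≼⇒⊀ (inj₂ refl) = irrefl refl

  rank : E n → ℕ
  rank x = sum (map (λ z → select (z <? x) 1) (elems n))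

  rank-mono : ∀ {x y} → x ≺ y → rank x < rank y
  rank-mono {x} {y} x≺y = sum-mono-strict _ _ (elems n) (elems-complete x) below-x⊆below-y x-below-y
    where
    below-x⊆below-y : ∀ z → select (z <? x) 1 ≤ select (z <? y) 1
    below-x⊆below-y z with z <? x | z <? y
    ... | no _    | _       = z≤n
    ... | yes _   | yes _   = ℕ.≤-refl
    ... | yes z≺x | no z⊀y  = contradiction (≺-trans z≺x x≺y) z⊀y
    x-below-y : select (x <? x) 1 < select (x <? y) 1
    x-below-y with x <? x | x <? y
    ... | yes x≺x | _       = contradiction x≺x (irrefl refl)
    ... | no _    | yes _   = s≤s z≤n
    ... | no _    | no x⊀y  = contradiction x≺y x⊀y

  aboveList : E n → ESet n → List (E n)
  aboveList t X = filter (λ x → x ∈E? X ×-dec ¬? (x <? t)) (elems n)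

  notBelow : E n → E n → ℕ
  notBelow t x = select (¬? (x <? t)) 1

  notBelow-mono : ∀ t {x y} → x ≺ y → notBelow t x ≤ notBelow t y
  notBelow-mono t {x} {y} x≺y with x <? t | y <? t
  ... | yes _   | _       = z≤n
  ... | no _    | no _    = ℕ.≤-refl
  ... | no x⊀t  | yes y≺t = contradiction (≺-trans x≺y y≺t) x⊀t

  above : E n → ESet n → ℕ
  above t = weight (notBelow t)

  above-length : ∀ t X → above t X ≡ length (aboveList t X)
  above-length t X = trans (sum-cong _ _ (elems n) (λ x _ → select-× (x ∈E? X) (¬? (x <? t)) 1))
                           (sum-select-filter (λ x → x ∈E? X ×-dec ¬? (x <? t)) (elems n))

  greatest : ∀ {p} {P : Pred (E n) p} → Decidable P → (∀ x → ¬ P x) ⊎ ∃[ y ] (P y × ∀ z → P z → z ≼ y)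
  greatest {P = P} P? = greatest-of (filter P? (elems n)) (all-filter P? (elems n))
                                    (λ z → ∈-filter⁺ P? (elems-complete z))
    where
    open Extrema totalOrder using (max; ⊥≤max; xs≤max; argmax-all)
    greatest-of : ∀ ys → All P ys → (∀ z → P z → z ∈ ys) →
                  (∀ x → ¬ P x) ⊎ ∃[ y ] (P y × ∀ z → P z → z ≼ y)
    greatest-of []       _          complete = inj₁ (λ x px → ¬Any[] (complete x px))
    greatest-of (y ∷ ys) (py ∷ pys) complete = inj₂ (max y ys , argmax-all (λ x → x) py pys , below-max)
      where
      below-max : ∀ z → P z → z ≼ max y ys
      below-max z pz with complete z pz
      ... | here refl = ⊥≤max y ys
      ... | there z∈  = All.lookup (xs≤max y ys) z∈

  enumeration : ∀ X {k} → ∣ X ∣E ≡ k → Σ (Fin k → E n) (Enumerates O X)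
  enumeration X refl = subst (λ m → Σ (Fin m → E n) (Enumerates O X)) length-sorted
                             (lookup sorted , increasing , covers)
    where
    sorted : List (E n)
    sorted = sort (members X)
    length-sorted : length sorted ≡ ∣ X ∣E
    length-sorted = trans (↭-length (sort-↭ (members X))) (length-members X)
    sorted-unique : Unique sorted
    sorted-unique = Permutation.Unique-resp-↭ (setoid (E n)) (↭⇒↭ₛ (↭-sym (sort-↭ (members X))))
                                             (Unique.filter⁺ (_∈E? X) (elems-unique n))
    increasing : ∀ i j → i Fin.< j → lookup sorted i ≺ lookup sorted j
    increasing i j i<j with lookup-mono-≤ totalOrder (sort-↗ (members X)) (ℕ.<⇒≤ i<j)
    ... | inj₁ i≺j = i≺j
    ... | inj₂ eq  = contradiction (lookup-injective sorted-unique i j eq) (Fin.<⇒≢ i<j)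
    covers : ∀ x → (x ∈E X → ∃[ i ] lookup sorted i ≡ x) × (∀ i → lookup sorted i ≡ x → x ∈E X)
    covers x = position , member
      where
      position : x ∈E X → ∃[ i ] lookup sorted i ≡ x
      position x∈X = index x∈sorted , sym (lookup-index x∈sorted)
        where
        x∈sorted : x ∈ sorted
        x∈sorted = ∈-resp-↭ (↭-sym (sort-↭ (members X))) (∈-filter⁺ (_∈E? X) (elems-complete x) x∈X)
      member : ∀ i → lookup sorted i ≡ x → x ∈E X
      member i refl = proj₂ (∈-filter⁻ (_∈E? X) {xs = elems n} (∈-resp-↭ (sort-↭ (members X)) (∈-lookup i)))

  module _ {k} {X : ESet n} {a : Fin k → E n} (enum : Enumerates O X a) where
    private
      increasing : ∀ i j → i Fin.< j → a i ≺ a j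
      increasing = proj₁ enum

    enumeration-mono : ∀ {i j} → i Fin.≤ j → a i ≼ a j
    enumeration-mono {i} {j} i≤j with Fin.<-cmp i j
    ... | tri< i<j _ _ = inj₁ (increasing i j i<j)
    ... | tri≈ _ refl _ = inj₂ refl
    ... | tri> _ _ j<i = contradiction i≤j (ℕ.<⇒≱ j<i)

    enumeration-injective : ∀ {i j} → a i ≡ a j → i ≡ j
    enumeration-injective {i} {j} aᵢ≡aⱼ with Fin.<-cmp i j
    ... | tri< i<j _ _ = contradiction (increasing i j i<j) (irrefl aᵢ≡aⱼ)
    ... | tri≈ _ i≡j _ = i≡j
    ... | tri> _ _ j<i = contradiction (increasing j i j<i) (irrefl (sym aᵢ≡aⱼ))

  equal-enumerations⇒≡ : ∀ {k X Y} {a b : Fin k → E n} → Enumerates O X a → Enumerates O Y b →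
                         (∀ i → a i ≡ b i) → X ≡ Y
  equal-enumerations⇒≡ {X = X} {Y} {a} {b} (_ , cover-X) (_ , cover-Y) a≗b = ESet-ext X⊆Y Y⊆X
    where
    X⊆Y : ∀ x → x ∈E X → x ∈E Y
    X⊆Y x x∈X with proj₁ (cover-X x) x∈X
    ... | i , refl = proj₂ (cover-Y (a i)) i (sym (a≗b i))
    Y⊆X : ∀ x → x ∈E Y → x ∈E X
    Y⊆X x x∈Y with proj₁ (cover-Y x) x∈Y
    ... | i , refl = proj₂ (cover-X (b i)) i (a≗b i)

  gale-antisym : ∀ {k X Y} → ∣ X ∣E ≡ k → ∣ Y ∣E ≡ k → GaleLeq O k X Y → GaleLeq O k Y X → X ≡ Y
  gale-antisym {X = X} {Y} size-X size-Y X≤Y Y≤X with enumeration X size-X | enumeration Y size-Y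
  ... | x , enum-x | y , enum-y =
    equal-enumerations⇒≡ enum-x enum-y (λ i → ≼-antisym (X≤Y x y enum-x enum-y i) (Y≤X y x enum-y enum-x i))

  positionsFrom : ∀ {k} → Fin k → List (Fin k)
  positionsFrom {k} i = filter (i Fin.≤?_) (allFin k)

  positionsFrom-unique : ∀ {k} (i : Fin k) → Unique (positionsFrom i)
  positionsFrom-unique {k} i = Unique.filter⁺ (i Fin.≤?_) (Unique.allFin⁺ k)

  tail-above : ∀ {k B} {b : Fin k → E n} → Enumerates O B b → ∀ i →
               length (positionsFrom i) ≤ length (aboveList (b i) B)
  tail-above {B = B} {b} enum i = subst (_≤ _) (length-map b (positionsFrom i))
    (unique-⊆-length (Unique.map⁺ (enumeration-injective enum) (positionsFrom-unique i)) tail⊆above)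
    where
    tail⊆above : map b (positionsFrom i) ⊆ aboveList (b i) B
    tail⊆above z∈ with ∈-map⁻ b z∈
    ... | m , m∈ , refl = ∈-filter⁺ _ (elems-complete (b m)) (proj₂ (proj₂ enum (b m)) m refl , ≼⇒⊀ bᵢ≼bₘ)
      where
      bᵢ≼bₘ : b i ≼ b m
      bᵢ≼bₘ = enumeration-mono enum (proj₂ (∈-filter⁻ (i Fin.≤?_) {xs = allFin _} m∈))

  head-below : ∀ {k A} {a : Fin k → E n} → Enumerates O A a → ∀ {i t} → a i ≺ t →
               suc (length (aboveList t A)) ≤ length (positionsFrom i)
  head-below {A = A} {a} enum {i} {t} aᵢ≺t = subst (_ ≤_) (length-map a (positionsFrom i))
    (unique-⊆-length (All.tabulate aᵢ-fresh ∷ Unique.filter⁺ _ (elems-unique n)) included)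
    where
    aᵢ-fresh : ∀ {z} → z ∈ aboveList t A → a i ≢ z
    aᵢ-fresh z∈ refl = proj₂ (proj₂ (∈-filter⁻ _ {xs = elems n} z∈)) aᵢ≺t
    included : (a i ∷ aboveList t A) ⊆ map a (positionsFrom i)
    included (here refl) = ∈-map⁺ a (∈-filter⁺ _ (∈-allFin i) (Fin.≤-refl {x = i}))
    included (there z∈) with ∈-filter⁻ _ {xs = elems n} z∈
    ... | _ , z∈A , z⊀t with proj₁ (proj₂ enum _) z∈A
    ...   | m , refl = ∈-map⁺ a (∈-filter⁺ _ (∈-allFin m) i≤m)
      where
      i≤m : i Fin.≤ m
      i≤m with i Fin.≤? m
      ... | yes i≤m′ = i≤m′
      ... | no i≰m   = contradiction (≺-trans (proj₁ enum m i (ℕ.≰⇒> i≰m)) aᵢ≺t) z⊀t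

  threshold⇒gale : ∀ {k A B} {a b : Fin k → E n} → Enumerates O A a → Enumerates O B b →
                   (∀ t → above t B ≤ above t A) → ∀ i → b i ≼ a i
  threshold⇒gale {A = A} {B} {a} {b} enum-a enum-b fewer i with compare (b i) (a i)
  ... | tri< bᵢ≺aᵢ _ _ = inj₁ bᵢ≺aᵢ
  ... | tri≈ _ bᵢ≡aᵢ _ = inj₂ bᵢ≡aᵢ
  ... | tri> _ _ aᵢ≺bᵢ = contradiction squeeze (ℕ.<-irrefl refl)
    where
    open ℕ.≤-Reasoning
    squeeze : length (positionsFrom i) < length (positionsFrom i)
    squeeze = begin-strict
      length (positionsFrom i)       ≤⟨ tail-above enum-b i ⟩
      length (aboveList (b i) B)     ≡⟨ above-length (b i) B ⟨
      above (b i) B                  ≤⟨ fewer (b i) ⟩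
      above (b i) A                  ≡⟨ above-length (b i) A ⟩
      length (aboveList (b i) A)     <⟨ head-below enum-a aᵢ≺bᵢ ⟩
      length (positionsFrom i)       ∎

module Domination {n} (O : AdmissibleOrder n) (𝓑 : List (ESet n)) (exchange : SymmetricExchange 𝓑)
                  {A : ESet n} (A∈𝓑 : A ∈ 𝓑)
                  (A-heaviest : ∀ X → X ∈ 𝓑 → weight (OrderFacts.rank O) X ≤ weight (OrderFacts.rank O) A) where
  open AdmissibleOrder O renaming (_<_ to _≺_)
  open IsStrictTotalOrder isStrictTotalOrder using (compare)
  open OrderFacts O

  -- Exchanging j ∈ A for y ∉ A inside 𝓑 always replaces j by a smaller element:
  -- if j ≺ y, the exchanged set would have larger total rank than A.
  exchange-from-A : ∀ {y j} → y ∉E A → j ∈E A → removeE j (insertE y A) ∈ 𝓑 → y ≺ j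
  exchange-from-A {y} {j} y∉A j∈A A′∈𝓑 with compare y j
  ... | tri< y≺j _ _ = y≺j
  ... | tri≈ _ refl _ = contradiction j∈A y∉A
  ... | tri> _ _ j≺y = contradiction (ℕ.+-mono-<-≤ (rank-mono j≺y) (A-heaviest _ A′∈𝓑))
                                     (ℕ.<-irrefl (weight-exchange rank A y∉A j∈A (λ { refl → y∉A j∈A })))

  distance : ESet n → ℕ
  distance = weight (λ x → select (¬? (x ∈E? A)) 1)

  -- If y is the greatest element of B ∖ A, exchanging twice yields B′ ∈ 𝓑 one step closer to A
  -- whose threshold counts are at least those of B.
  step-towards-A : ∀ {B y} → B ∈ 𝓑 → y ∈E B → y ∉E A → (∀ z → z ∈E B × z ∉E A → z ≼ y) →
                   ∃[ B′ ] (B′ ∈ 𝓑 × suc (distance B′) ≡ distance B × ∀ t → above t B ≤ above t B′)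
  step-towards-A {B} {y} B∈𝓑 y∈B y∉A y-greatest
    with exchange A B A∈𝓑 B∈𝓑 y y∈B y∉A
  ... | j′ , j′∈A , j′∉B , A′∈𝓑
    with exchange B A B∈𝓑 A∈𝓑 j′ j′∈A j′∉B
  ... | j , j∈B , j∉A , B′∈𝓑 = B′ , B′∈𝓑 , closer , higher
    where
    B′ : ESet n
    B′ = removeE j (insertE j′ B)
    j≢j′ : j ≢ j′
    j≢j′ refl = j′∉B j∈B
    j≺j′ : j ≺ j′
    j≺j′ = ≼-≺-trans (y-greatest j (j∈B , j∉A)) (exchange-from-A y∉A j′∈A A′∈𝓑)
    closer : suc (distance B′) ≡ distance B
    closer = begin
      1 + distance B′
        ≡⟨ cong (_+ distance B′) (select-yes j∉A (¬? (j ∈E? A)) 1) ⟨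
      select (¬? (j ∈E? A)) 1 + distance B′
        ≡⟨ weight-exchange _ B j′∉B j∈B j≢j′ ⟩
      select (¬? (j′ ∈E? A)) 1 + distance B
        ≡⟨ cong (_+ distance B) (select-no (λ j′∉A → j′∉A j′∈A) (¬? (j′ ∈E? A)) 1) ⟩
      distance B ∎
      where open ≡-Reasoning
    higher : ∀ t → above t B ≤ above t B′
    higher t = ℕ.+-cancelˡ-≤ (notBelow t j′) _ _ (begin
      notBelow t j′ + above t B ≡⟨ weight-exchange (notBelow t) B j′∉B j∈B j≢j′ ⟨
      notBelow t j + above t B′ ≤⟨ ℕ.+-monoˡ-≤ _ (notBelow-mono t j≺j′) ⟩
      notBelow t j′ + above t B′ ∎)
      where open ℕ.≤-Reasoning

  dominance : ∀ {B} → B ∈ 𝓑 → ∀ t → above t B ≤ above t A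
  dominance {B} B∈𝓑 t = by-distance (distance B) B∈𝓑 refl
    where
    by-distance : ∀ d {B} → B ∈ 𝓑 → distance B ≡ d → above t B ≤ above t A
    by-distance d {B} B∈𝓑 dist-B with greatest (λ z → z ∈E? B ×-dec ¬? (z ∈E? A))
    ... | inj₁ B∖A-empty =
      weight-mono (notBelow t) (λ z z∈B → decidable-stable (z ∈E? A) (λ z∉A → B∖A-empty z (z∈B , z∉A)))
    ... | inj₂ (y , (y∈B , y∉A) , y-greatest) with step-towards-A B∈𝓑 y∈B y∉A y-greatest | d
    ...   | B′ , B′∈𝓑 , closer , higher | zero    = contradiction (trans closer dist-B) λ ()
    ...   | B′ , B′∈𝓑 , closer , higher | suc d′  =
      ℕ.≤-trans (higher t) (by-distance d′ B′∈𝓑 (ℕ.suc-injective (trans closer dist-B)))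

module _ {a} {A : Set a} (f : A → ℕ) (x : A) (xs : List A) where
  open Extremaℕ using (argmax; argmax-all; f[⊥]≤f[argmax]; f[xs]≤f[argmax])

  argmax-∈ : argmax f x xs ∈ x ∷ xs
  argmax-∈ = argmax-all f {P = _∈ x ∷ xs} (here refl) (All.tabulate there)

  argmax-maximal : ∀ {y} → y ∈ x ∷ xs → f y ≤ f (argmax f x xs)
  argmax-maximal (here refl) = f[⊥]≤f[argmax] {f = f} x xs
  argmax-maximal (there y∈)  = All.lookup (f[xs]≤f[argmax] {f = f} x xs) y∈

theorem3 : (n k : ℕ) → k ≤ n → (𝓑 : List (ESet n)) →
    (∃[ X ] X ∈ 𝓑) →
    (∀ X → X ∈ 𝓑 → Admissible X × ∣ X ∣E ≡ k) →
    SymmetricExchange 𝓑 →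
    MaximalityProperty k 𝓑
theorem3 n k _ [] (_ , ()) _ _ _
theorem3 n k _ 𝓑@(Y ∷ 𝓑′) _ members-of-𝓑 exchange O = A , (A∈𝓑 , A-maximal) , A-unique
  where
  open OrderFacts O
  A : ESet n
  A = Extremaℕ.argmax (weight rank) Y 𝓑′
  A∈𝓑 : A ∈ 𝓑
  A∈𝓑 = argmax-∈ (weight rank) Y 𝓑′
  open Domination O 𝓑 exchange A∈𝓑 (λ X → argmax-maximal (weight rank) Y 𝓑′)
  size : ∀ {X} → X ∈ 𝓑 → ∣ X ∣E ≡ k
  size X∈𝓑 = proj₂ (members-of-𝓑 _ X∈𝓑)
  above-all : ∀ {B} → B ∈ 𝓑 → GaleLeq O k B A
  above-all B∈𝓑 b a enum-b enum-a = threshold⇒gale enum-a enum-b (dominance B∈𝓑)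
  A-maximal : ∀ X → X ∈ 𝓑 → GaleLeq O k A X → X ≡ A
  A-maximal X X∈𝓑 A≤X = gale-antisym (size X∈𝓑) (size A∈𝓑) (above-all X∈𝓑) A≤X
  A-unique : ∀ M → MaximalIn O k 𝓑 M → M ≡ A
  A-unique M (M∈𝓑 , M-maximal) = sym (M-maximal A A∈𝓑 (above-all M∈𝓑))
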